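{- Let $\vdash$ be a logic with a partition function, and let $X=\langle\langle I,\le\rangle,\{\langle\mathbf{A}_i,F_i\rangle\}_{i\in I},\{f_{ij}:i\le j\}\rangle$ be a directed system of models of $\vdash$. Let $J\subseteq I$ be an upset, and for every $i\in I$ put $G_i=A_i$ if $i\in J$ and $G_i=F_i$ otherwise. Then $\bigcup_{i\in I}G_i$ is a $\vdash^{l}$-filter on the Płonka sum $\mathrm{PL}(\mathbf{A}_i)_{i\in I}$ of the algebras of $X$.
   Context: Fix an algebraic language without constant symbols; $\mathrm{Var}(\varphi)$ is the set of variables of $\varphi$. A logic is a substitution-invariant consequence relation. The left variable inclusion companion: $\Gamma\vdash^{l}\varphi$ iff there is $\Gamma'\subseteq\Gamma$ with $\bigcup_{\gamma\in\Gamma'}\mathrm{Var}(\gamma)\subseteq\mathrm{Var}(\varphi)$ and $\Gamma'\vdash\varphi$. A matrix $\langle\mathbf{A},F\rangle$ is a model of a logic if $\Gamma\vdash\varphi$ and $h[\Gamma]\subseteq F$ (homomorphism $h$ from the formula algebra) imply $h(\varphi)\in F$; a subset $F$ with this property is a filter of the logic on $\mathbf{A}$. $\Omega^{\mathbf{A}}F$ is the largest congruence compatible with $F$; the Suszko congruence is the intersection of $\Omega^{\mathbf{A}}G$ over $\vdash$-filters $G\supseteq F$; $\mathrm{Alg}(\vdash)$ is the class of algebras having a model of identity Suszko congruence. A binary operation $\cdot$ is a partition function on $\mathbf{A}$ if for all $a,b,c$ and basic operations $g$ of arity $n\ge1$: $a\cdot a=a$; $a\cdot(b\cdot c)=(a\cdot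 b)\cdot c$; $a\cdot(b\cdot c)=a\cdot(c\cdot b)$; $g(a_1,\dots,a_n)\cdot b=g(a_1\cdot b,\dots,a_n\cdot b)$; $b\cdot g(a_1,\dots,a_n)=b\cdot a_1\cdot\ldots\cdot a_n$; $\vdash$ has a partition function if some formula $x\cdot y$ in which both $x,y$ occur satisfies $x\vdash x\cdot y$ and is a partition function on every $\mathbf{A}\in\mathrm{Alg}(\vdash)$. A directed system of matrices: semilattice $\langle I,\vee\rangle$ (order $i\le j$ iff $i\vee j=j$), matrices $\langle\mathbf{A}_i,F_i\rangle$ with pairwise disjoint universes, homomorphisms $f_{ij}\colon\mathbf{A}_i\to\mathbf{A}_j$ for $i\le j$ with $f_{ij}[F_i]\subseteq F_j$, $f_{ii}=\mathrm{id}$, $f_{ik}=f_{jk}\circ f_{ij}$. The Płonka sum $\mathrm{PL}(\mathbf{A}_i)_{i\in I}$ is the algebra with universe $\bigcup_iA_i$ and $f(a_1,\dots,a_n)=f^{\mathbf{A}_j}(f_{i_1j}(a_1),\dots,f_{i_nj}(a_n))$ for $a_k\in A_{i_k}$, $j=i_1\vee\dots\vee i_n$. An upset of $I$ is a set $J$ with $i\in J$, $i\le k$ implying $k\in J$. -}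

module Defs where

open import Level using (0ℓ)
open import Data.Nat using (ℕ; zero; suc)
open import Data.Fin using (Fin)
open import Data.Vec using (Vec; []; _∷_; map; toList)
open import Data.Vec.Relation.Unary.All using (All; []; _∷_)
open import Data.Vec.Relation.Unary.Any using (Any)
open import Data.Vec.Relation.Binary.Pointwise.Inductive using (Pointwise)
open import Data.List using (foldl)
open import Data.Product using (Σ; _×_; _,_; proj₁; proj₂)
open import Data.Sum using (_⊎_)
open import Relation.Unary using (Pred; _⊆_; _∈_)
open import Relation.Binary.PropositionalEquality using (_≡_; refl; sym; trans; cong)
open import Relation.Nullary using (¬_)

-- Algebraic languages without constant symbols.
-- Every operation symbol g has arity  suc (arity⁻ g)  ≥ 1.

record Signature : Set₁ where
  field
    Op      : Set
    arity⁻  : Op → ℕ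

  arity : Op → ℕ
  arity g = suc (arity⁻ g)

module _ (S : Signature) where
  open Signature S

  record Algebra : Set₁ where
    field
      Carrier : Set
      ⟦_⟧     : (g : Op) → Vec Carrier (arity g) → Carrier

  open Algebra public

  data Fm : Set where
    var : ℕ → Fm
    op  : (g : Op) → Vec Fm (arity g) → Fm

  FmAlg : Algebra
  FmAlg = record { Carrier = Fm ; ⟦_⟧ = op }

  IsHom : (A B : Algebra) → (Carrier A → Carrier B) → Set
  IsHom A B h = ∀ (g : Op) (as : Vec (Carrier A) (arity g)) →
    h (⟦ A ⟧ g as) ≡ ⟦ B ⟧ g (map h as)

  module _ (A : Algebra) (v : ℕ → Carrier A) where
    eval  : Fm → Carrier A
    evals : ∀ {n} → Vec Fm n → Vec (Carrier A) n
    eval (var x)   = v x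
    eval (op g ts) = ⟦ A ⟧ g (evals ts)
    evals []       = []
    evals (t ∷ ts) = eval t ∷ evals ts

  data _occursIn_ (x : ℕ) : Fm → Set where
    here : x occursIn var x
    there : ∀ {g ts} → Any (x occursIn_) ts → x occursIn op g ts

  Var : Fm → Pred ℕ 0ℓ
  Var φ x = x occursIn φ

  subst : (ℕ → Fm) → Fm → Fm
  subst σ = eval FmAlg σ

  image : (Fm → Fm) → Pred Fm 0ℓ → Pred Fm 0ℓ
  image σ Γ ψ = Σ Fm λ γ → γ ∈ Γ × ψ ≡ σ γ

  record Logic : Set₁ where
    field
      _⊢_     : Pred Fm 0ℓ → Fm → Set
      reflex  : ∀ {Γ φ} → φ ∈ Γ → Γ ⊢ φ
      monot   : ∀ {Γ Δ φ} → Γ ⊆ Δ → Γ ⊢ φ → Δ ⊢ φ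
      cut     : ∀ {Γ Δ φ} → (∀ {δ} → δ ∈ Δ → Γ ⊢ δ) → Δ ⊢ φ → Γ ⊢ φ
      structl : ∀ {Γ φ} (σ : ℕ → Fm) → Γ ⊢ φ → image (subst σ) Γ ⊢ subst σ φ

  leftCompanion : (Pred Fm 0ℓ → Fm → Set) → Pred Fm 0ℓ → Fm → Set₁
  leftCompanion _⊢_ Γ φ =
    Σ (Pred Fm 0ℓ) λ Γ' → Γ' ⊆ Γ ×
      (∀ {γ} → γ ∈ Γ' → Var γ ⊆ Var φ) × (Γ' ⊢ φ)

  -- filters of a relation R (ℓ = 0 or 1 for the level of R) on an algebra
  IsFilterOf : ∀ {ℓ} → (Pred Fm 0ℓ → Fm → Set ℓ) → (A : Algebra) →
               Pred (Carrier A) 0ℓ → Set (Level.suc 0ℓ Level.⊔ ℓ)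
  IsFilterOf R A F = ∀ (Γ : Pred Fm 0ℓ) (φ : Fm) (h : Fm → Carrier A) →
    IsHom FmAlg A h → R Γ φ → (∀ {γ} → γ ∈ Γ → h γ ∈ F) → h φ ∈ F

  -- matrix ⟨A,F⟩ is a model of L  iff  F is an L-filter on A
  IsModel : Logic → (A : Algebra) → Pred (Carrier A) 0ℓ → Set₁
  IsModel L = IsFilterOf (Logic._⊢_ L)

  record IsCongruence (A : Algebra) (θ : Carrier A → Carrier A → Set) : Set where
    field
      refl′  : ∀ {a} → θ a a
      sym′   : ∀ {a b} → θ a b → θ b a
      trans′ : ∀ {a b c} → θ a b → θ b c → θ a c
      compat : ∀ (g : Op) {as bs : Vec (Carrier A) (arity g)} →
               Pointwise θ as bs → θ (⟦ A ⟧ g as) (⟦ A ⟧ g bs)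

  CompatibleWith : (A : Algebra) → (Carrier A → Carrier A → Set) →
                   Pred (Carrier A) 0ℓ → Set
  CompatibleWith A θ F = ∀ {a b} → θ a b → a ∈ F → b ∈ F

  -- Leibniz congruence Ω^A F: the largest congruence compatible with F,
  -- i.e. a Ω b iff a θ b for some congruence θ compatible with F.
  Ω : (A : Algebra) → Pred (Carrier A) 0ℓ → Carrier A → Carrier A → Set₁
  Ω A F a b = Σ (Carrier A → Carrier A → Set) λ θ →
    IsCongruence A θ × CompatibleWith A θ F × θ a b

  Suszko : Logic → (A : Algebra) → Pred (Carrier A) 0ℓ →
           Carrier A → Carrier A → Set₁
  Suszko L A F a b = ∀ (G : Pred (Carrier A) 0ℓ) → F ⊆ G →
    IsModel L A G → Ω A G a b

  InAlg : Logic → Algebra → Set₁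
  InAlg L A = Σ (Pred (Carrier A) 0ℓ) λ F → IsModel L A F ×
    (∀ a b → Suszko L A F a b → a ≡ b)

  IsPartitionFunction : (A : Algebra) → (Carrier A → Carrier A → Carrier A) → Set
  IsPartitionFunction A _·_ =
      (∀ a → a · a ≡ a)
    × (∀ a b c → a · (b · c) ≡ (a · b) · c)
    × (∀ a b c → a · (b · c) ≡ a · (c · b))
    × (∀ (g : Op) (as : Vec (Carrier A) (arity g)) b →
         ⟦ A ⟧ g as · b ≡ ⟦ A ⟧ g (map (_· b) as))
    × (∀ (g : Op) (as : Vec (Carrier A) (arity g)) b →
         b · ⟦ A ⟧ g as ≡ foldl _·_ b (toList as))

  -- x = var 0, y = var 1; binary operation induced by formula t on A
  binOp : (A : Algebra) → Fm → Carrier A → Carrier A → Carrier A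
  binOp A t a b = eval A (λ { zero → a ; (suc zero) → b ; (suc (suc _)) → a }) t

  HasPartitionFunction : Logic → Set₁
  HasPartitionFunction L = Σ Fm λ t →
      (∀ {x} → x occursIn t → x ≡ 0 ⊎ x ≡ 1)
    × 0 occursIn t × 1 occursIn t
    × Logic._⊢_ L (λ ψ → ψ ≡ var 0) t
    × (∀ (A : Algebra) → InAlg L A → IsPartitionFunction A (binOp A t))

  record DirectedSystem (L : Logic) : Set₁ where
    field
      I       : Set
      _∨_     : I → I → I
      ∨-idem  : ∀ i → i ∨ i ≡ i
      ∨-comm  : ∀ i j → i ∨ j ≡ j ∨ i
      ∨-assoc : ∀ i j k → (i ∨ j) ∨ k ≡ i ∨ (j ∨ k)

    _≤_ : I → I → Set
    i ≤ j = i ∨ j ≡ j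

    field
      𝐀     : I → Algebra
      F     : (i : I) → Pred (Carrier (𝐀 i)) 0ℓ
      model : ∀ i → IsModel L (𝐀 i) (F i)
      f     : ∀ {i j} → .(i ≤ j) → Carrier (𝐀 i) → Carrier (𝐀 j)
      f-hom : ∀ {i j} .(p : i ≤ j) → IsHom (𝐀 i) (𝐀 j) (f p)
      f-F   : ∀ {i j} .(p : i ≤ j) {a} → a ∈ F i → f p a ∈ F j
      f-id  : ∀ {i} .(p : i ≤ i) a → f p a ≡ a
      f-∘   : ∀ {i j k} .(p : i ≤ j) .(q : j ≤ k) .(r : i ≤ k) a →
              f r a ≡ f q (f p a)

    ≤-∨ˡ : ∀ i j → i ≤ (i ∨ j)
    ≤-∨ˡ i j = trans (sym (∨-assoc i i j)) (cong (_∨ j) (∨-idem i))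

    ≤-∨ʳ : ∀ i j → j ≤ (i ∨ j)
    ≤-∨ʳ i j = trans (cong (j ∨_) (∨-comm i j))
                 (trans (sym (∨-assoc j j i))
                   (trans (cong (_∨ i) (∨-idem j)) (∨-comm j i)))

    ≤-trans : ∀ {i j k} → i ≤ j → j ≤ k → i ≤ k
    ≤-trans {i} {j} {k} p q =
      trans (cong (i ∨_) (sym q))
        (trans (sym (∨-assoc i j k)) (trans (cong (_∨ k) p) q))

    ⋁ : ∀ {n} → Vec I (suc n) → I
    ⋁ (i ∷ [])     = i
    ⋁ (i ∷ k ∷ is) = i ∨ ⋁ (k ∷ is)

    ≤⋁ : ∀ {n} (is : Vec I (suc n)) → All (_≤ ⋁ is) is
    ≤⋁ (i ∷ [])     = ∨-idem i ∷ []
    ≤⋁ (i ∷ k ∷ is) = ≤-∨ˡ i _ ∷ go (≤⋁ (k ∷ is))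
      where
      go : ∀ {m} {js : Vec I m} → All (_≤ ⋁ (k ∷ is)) js → All (_≤ (i ∨ ⋁ (k ∷ is))) js
      go []       = []
      go (p ∷ ps) = ≤-trans p (≤-∨ʳ i _) ∷ go ps

    PlCarrier : Set
    PlCarrier = Σ I λ i → Carrier (𝐀 i)

    liftTo : ∀ {n} (j : I) (as : Vec PlCarrier n) →
             All (_≤ j) (map proj₁ as) → Vec (Carrier (𝐀 j)) n
    liftTo j []              []       = []
    liftTo j ((i , a) ∷ as) (p ∷ ps) = f p a ∷ liftTo j as ps

    Płonka : Algebra
    Płonka = record
      { Carrier = PlCarrier
      ; ⟦_⟧ = λ g as → ⋁ (map proj₁ as) ,
                 ⟦ 𝐀 (⋁ (map proj₁ as)) ⟧ g (liftTo _ as (≤⋁ (map proj₁ as)))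
      }

    IsUpset : Pred I 0ℓ → Set
    IsUpset J = ∀ {i k} → i ∈ J → i ≤ k → k ∈ J

    -- ⋃_i G_i with G_i = A_i if i ∈ J and G_i = F_i otherwise
    ⋃G : Pred I 0ℓ → Pred PlCarrier 0ℓ
    ⋃G J (i , a) = ¬ (i ∈ J) → a ∈ F i

module Submission where

open import Defs
open import Level using (0ℓ)
open import Data.Nat using (ℕ; suc; _≟_)
open import Data.Vec using (Vec; []; _∷_; map)
open import Data.Vec.Relation.Unary.All using (All; []; _∷_)
open import Data.Vec.Relation.Unary.Any using (Any; here; there)
open import Data.Product using (_,_; proj₁; proj₂)
open import Data.Empty using (⊥-elim)
open import Relation.Nullary using (Dec; yes; no)
open import Relation.Unary using (Pred; _∈_; _⊆_)
open import Relation.Binary.PropositionalEquality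
  using (_≡_; refl; sym; trans; cong; cong₂; module ≡-Reasoning)
  renaming (subst to ≡-subst)

-- Let h be a homomorphism into the Płonka sum and k the index of h φ.
-- If k ∈ J there is nothing to show. Otherwise, since Var γ ⊆ Var φ for γ ∈ Γ',
-- the index of h γ lies below k, hence outside the upset J, so h γ ∈ F (index γ).
-- Pushing the values of the variables of φ into 𝐀 k along the transition maps gives
-- a homomorphism h' into 𝐀 k that agrees with f ∘ h on every formula whose variables
-- occur in φ; as ⟨𝐀 k , F k⟩ is a model of ⊢, h' φ = h φ lies in F k.

module _ (S : Signature) where

  Vars : ∀ {n} → Vec (Fm S) n → Pred ℕ 0ℓ
  Vars ts x = Any (λ t → x ∈ Var S t) ts

  occurs? : ∀ x ψ → Dec (x ∈ Var S ψ)
  occurs-any? : ∀ {n} x (ts : Vec (Fm S) n) → Dec (x ∈ Vars ts)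
  occurs? x (var y) with x ≟ y
  ... | yes refl = yes here
  ... | no x≢y   = no λ { here → x≢y refl }
  occurs? x (op g ts) with occurs-any? x ts
  ... | yes o = yes (there o)
  ... | no ¬o = no λ { (there o) → ¬o o }
  occurs-any? x []       = no λ ()
  occurs-any? x (t ∷ ts) with occurs? x t | occurs-any? x ts
  ... | yes o | _     = yes (here o)
  ... | no _  | yes o = yes (there o)
  ... | no ¬o | no ¬p = no λ { (here o) → ¬o o ; (there p) → ¬p p }

  module _ (A : Algebra S) (v : ℕ → Carrier A) where

    evals≡map-eval : ∀ {n} (ts : Vec (Fm S) n) → evals S A v ts ≡ map (eval S A v) ts
    evals≡map-eval []       = refl
    evals≡map-eval (t ∷ ts) = cong (eval S A v t ∷_) (evals≡map-eval ts)

    eval-isHom : IsHom S (FmAlg S) A (eval S A v)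
    eval-isHom g ts = cong (⟦ A ⟧ g) (evals≡map-eval ts)

  module _ {L : Logic S} (X : DirectedSystem S L) where
    open DirectedSystem X

    ⋁-least : ∀ {n k} (is : Vec I (suc n)) → All (_≤ k) is → ⋁ is ≤ k
    ⋁-least (i ∷ [])     (p ∷ []) = p
    ⋁-least {k = k} (i ∷ j ∷ is) (p ∷ ps) =
      trans (∨-assoc i _ k) (trans (cong (i ∨_) (⋁-least (j ∷ is) ps)) p)

    f-cong : ∀ {k} {e e′ : PlCarrier} → e ≡ e′ →
             (p : proj₁ e ≤ k) (p′ : proj₁ e′ ≤ k) → f p (proj₂ e) ≡ f p′ (proj₂ e′)
    f-cong refl _ _ = refl

  module PłonkaHom {L : Logic S} (X : DirectedSystem S L)
                   (h : Fm S → DirectedSystem.PlCarrier X)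
                   (h-hom : IsHom S (FmAlg S) (DirectedSystem.Płonka X) h) where
    open DirectedSystem X

    index : Fm S → I
    index ψ = proj₁ (h ψ)

    indices : ∀ {n} → Vec (Fm S) n → Vec I n
    indices ts = map proj₁ (map h ts)

    index-op : ∀ g ts → index (op g ts) ≡ ⋁ (indices ts)
    index-op g ts = cong proj₁ (h-hom g ts)

    var-index-≤ : ∀ {x} ψ → x ∈ Var S ψ → index (var x) ≤ index ψ
    var-index-≤-any : ∀ {x n j} (ts : Vec (Fm S) n) → x ∈ Vars ts →
                      All (_≤ j) (indices ts) → index (var x) ≤ j
    var-index-≤ (var _)   here      = ∨-idem _
    var-index-≤ (op g ts) (there o) = ≡-subst (index (var _) ≤_) (sym (index-op g ts))
      (var-index-≤-any ts o (≤⋁ (indices ts)))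
    var-index-≤-any (t ∷ ts) (here o)  (p ∷ ps) = ≤-trans (var-index-≤ t o) p
    var-index-≤-any (t ∷ ts) (there o) (p ∷ ps) = var-index-≤-any ts o ps

    index-≤ : ∀ {k} ψ → (∀ {x} → x ∈ Var S ψ → index (var x) ≤ k) → index ψ ≤ k
    indices-≤ : ∀ {k n} (ts : Vec (Fm S) n) →
                (∀ {x} → x ∈ Vars ts → index (var x) ≤ k) → All (_≤ k) (indices ts)
    index-≤ (var x)       bound = bound here
    index-≤ {k} (op g ts) bound = ≡-subst (_≤ k) (sym (index-op g ts))
      (⋁-least X (indices ts) (indices-≤ ts (λ o → bound (there o))))
    indices-≤ []       bound = []
    indices-≤ (t ∷ ts) bound =
      index-≤ t (λ o → bound (here o)) ∷ indices-≤ ts (λ o → bound (there o))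

    index-mono : ∀ {γ φ} → Var S γ ⊆ Var S φ → index γ ≤ index φ
    index-mono {γ} {φ} sub = index-≤ γ (λ o → var-index-≤ φ (sub o))

    module _ {k : I} (v : ℕ → Carrier (𝐀 k)) where

      AgreesOn : Pred ℕ 0ℓ → Set
      AgreesOn V = ∀ {x} (q : index (var x) ≤ k) → x ∈ V →
                   v x ≡ f q (proj₂ (h (var x)))

      eval-fiber : ∀ ψ (p : index ψ ≤ k) → AgreesOn (Var S ψ) →
                   eval S (𝐀 k) v ψ ≡ f p (proj₂ (h ψ))
      evals-fiber : ∀ {n j} (ts : Vec (Fm S) n) (ps : All (_≤ j) (indices ts)) (q : j ≤ k) →
                    AgreesOn (Vars ts) →
                    evals S (𝐀 k) v ts ≡ map (f q) (liftTo j (map h ts) ps)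
      eval-fiber (var x)   p agree = agree p here
      eval-fiber (op g ts) p agree = begin
        ⟦ 𝐀 k ⟧ g (evals S (𝐀 k) v ts)
          ≡⟨ cong (⟦ 𝐀 k ⟧ g) (evals-fiber ts ps q (λ q′ o → agree q′ (there o))) ⟩
        ⟦ 𝐀 k ⟧ g (map (f q) (liftTo j (map h ts) ps))
          ≡⟨ sym (f-hom q g _) ⟩
        f q (⟦ 𝐀 j ⟧ g (liftTo j (map h ts) ps))
          ≡⟨ f-cong X (sym (h-hom g ts)) q p ⟩
        f p (proj₂ (h (op g ts)))
          ∎
        where
        open ≡-Reasoning
        j  = ⋁ (indices ts)
        ps = ≤⋁ (indices ts)
        q  = ≡-subst (_≤ k) (index-op g ts) p
      evals-fiber []       []       q agree = refl
      evals-fiber (t ∷ ts) (p ∷ ps) q agree = cong₂ _∷_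
        (trans (eval-fiber t (≤-trans p q) (λ q′ o → agree q′ (here o))) (f-∘ p q _ _))
        (evals-fiber ts ps q (λ q′ o → agree q′ (there o)))

    module Restriction (φ : Fm S) where

      -- The value on variables outside φ is irrelevant; h φ merely inhabits 𝐀 (index φ).
      valuation : ℕ → Carrier (𝐀 (index φ))
      valuation x with occurs? x φ
      ... | yes o = f (var-index-≤ φ o) (proj₂ (h (var x)))
      ... | no _  = proj₂ (h φ)

      valuation-agrees : AgreesOn valuation (Var S φ)
      valuation-agrees {x} q o with occurs? x φ
      ... | yes _ = refl
      ... | no ¬o = ⊥-elim (¬o o)

      restrict : Fm S → Carrier (𝐀 (index φ))
      restrict = eval S (𝐀 (index φ)) valuation

      restrict-isHom : IsHom S (FmAlg S) (𝐀 (index φ)) restrict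
      restrict-isHom = eval-isHom (𝐀 (index φ)) valuation

      restrict-agrees : ∀ {γ} (sub : Var S γ ⊆ Var S φ) →
                        restrict γ ≡ f (index-mono sub) (proj₂ (h γ))
      restrict-agrees {γ} sub =
        eval-fiber valuation γ (index-mono sub) (λ q o → valuation-agrees q (sub o))

      restrict-at-φ : restrict φ ≡ proj₂ (h φ)
      restrict-at-φ = trans (restrict-agrees (λ o → o)) (f-id _ _)

lemma5p1 : (S : Signature) (L : Logic S) → HasPartitionFunction S L →
    (X : DirectedSystem S L) (J : Pred (DirectedSystem.I X) 0ℓ) →
    DirectedSystem.IsUpset X J →
    IsFilterOf S (leftCompanion S (Logic._⊢_ L)) (DirectedSystem.Płonka X)
    (DirectedSystem.⋃G X J)
lemma5p1 S L _ X J J-upset Γ φ h h-hom (Γ′ , Γ′⊆Γ , Var-Γ′⊆Var-φ , Γ′⊢φ) h[Γ]⊆⋃G φ∉J =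
  ≡-subst (F (index φ)) restrict-at-φ
    (model (index φ) Γ′ φ restrict restrict-isHom Γ′⊢φ restrict[Γ′]⊆F)
  where
  open DirectedSystem X
  open PłonkaHom S X h h-hom
  open Restriction φ

  restrict[Γ′]⊆F : ∀ {γ} → γ ∈ Γ′ → restrict γ ∈ F (index φ)
  restrict[Γ′]⊆F γ∈Γ′ = ≡-subst (F (index φ)) (sym (restrict-agrees sub))
    (f-F _ (h[Γ]⊆⋃G (Γ′⊆Γ γ∈Γ′) λ γ∈J → φ∉J (J-upset γ∈J (index-mono sub))))
    where sub = Var-Γ′⊆Var-φ γ∈Γ′
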